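{- Let $P$ be a finite bounded poset with an interpolating EL-labelling $\gamma$, and let $m$ be an unrefinable chain $y=w_0\lessdot w_1\lessdot\cdots\lessdot w_r=z$ in $P$. Then the labels on $m$ all occur on the increasing chain from $y$ to $z$ and are pairwise distinct. Furthermore, every label on the increasing chain from $y$ to $z$ lies between the lowest and highest labels on $m$.
   Context: A poset is bounded if it has unique minimum $\hat0$ and maximum $\hat1$. An edge-labelling (map from covering relations to $\mathbb Z$) is an EL-labelling if for all $y<z$ there is a unique unrefinable chain from $y$ to $z$ with weakly increasing labels (the increasing chain), and its label sequence lexicographically precedes those of all other unrefinable chains from $y$ to $z$. It is interpolating if for every $y\lessdot u\lessdot z$, either $\gamma(y,u)<\gamma(u,z)$, or the increasing chain $y=w_0\lessdot\cdots\lessdot w_r=z$ has strictly increasing labels with $\gamma(w_0,w_1)=\gamma(u,z)$ and $\gamma(w_{r-1},w_r)=\gamma(y,u)$. -}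

module Defs where

open import Data.Nat using (ℕ)
open import Data.Fin using (Fin)
open import Data.Integer as ℤ using (ℤ)
open import Data.List using (List; []; _∷_; head; last)
open import Data.Maybe using (just)
open import Data.List.Relation.Unary.Linked using (Linked)
open import Data.List.Relation.Binary.Lex.Core using (Lex-<)
open import Data.Product using (Σ; _×_; ∃)
open import Data.Sum using (_⊎_)
open import Relation.Nullary using (¬_; Dec)
open import Relation.Binary.PropositionalEquality using (_≡_; _≢_)

record FinBoundedPoset : Set₁ where
  field
    n       : ℕ
    _≤_     : Fin n → Fin n → Set
    ≤-dec   : ∀ x y → Dec (x ≤ y)
    ≤-refl  : ∀ {x} → x ≤ x
    ≤-antisym : ∀ {x y} → x ≤ y → y ≤ x → x ≡ y
    ≤-trans : ∀ {x y z} → x ≤ y → y ≤ z → x ≤ z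
    bot     : Fin n
    top     : Fin n
    bot-min : ∀ x → bot ≤ x
    top-max : ∀ x → x ≤ top

  Elt : Set
  Elt = Fin n

  _<_ : Elt → Elt → Set
  x < y = x ≤ y × x ≢ y

  _⋖_ : Elt → Elt → Set
  x ⋖ y = x < y × (∀ w → x < w → ¬ (w < y))

module _ (P : FinBoundedPoset) where
  open FinBoundedPoset P

  -- An edge labelling: only its values on covering pairs are ever used.
  Labelling : Set
  Labelling = Elt → Elt → ℤ

  data Chain : Elt → Elt → Set where
    [] : ∀ {x} → Chain x x
    _∷_ : ∀ {x w z} → x ⋖ w → Chain w z → Chain x z

  vertices : ∀ {x z} → Chain x z → List Elt
  vertices {x} []       = x ∷ []
  vertices {x} (_ ∷ c)  = x ∷ vertices c

  module _ (γ : Labelling) where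

    labels : ∀ {x z} → Chain x z → List ℤ
    labels []                 = []
    labels (_∷_ {x} {w} _ c)  = γ x w ∷ labels c

    WeaklyIncreasing : ∀ {x z} → Chain x z → Set
    WeaklyIncreasing c = Linked ℤ._≤_ (labels c)

    StrictlyIncreasing : ∀ {x z} → Chain x z → Set
    StrictlyIncreasing c = Linked ℤ._<_ (labels c)

    _<lex_ : List ℤ → List ℤ → Set
    _<lex_ = Lex-< _≡_ ℤ._<_

    IsIncreasingChain : ∀ {x z} → Chain x z → Set
    IsIncreasingChain {x} {z} c =
      WeaklyIncreasing c
      × (∀ (c′ : Chain x z) → WeaklyIncreasing c′ → vertices c′ ≡ vertices c)
      × (∀ (c′ : Chain x z) → vertices c′ ≢ vertices c → labels c <lex labels c′)

    IsEL : Set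
    IsEL = ∀ y z → y < z → Σ (Chain y z) IsIncreasingChain

    IsInterpolating : Set
    IsInterpolating = ∀ y u z → y ⋖ u → u ⋖ z →
      (γ y u ℤ.< γ u z)
      ⊎ Σ (Chain y z) (λ c → IsIncreasingChain c
                             × StrictlyIncreasing c
                             × head (labels c) ≡ just (γ u z)
                             × last (labels c) ≡ just (γ y u))

{-# OPTIONS --safe #-}
module Submission where

-- Induction on y along the reversed order (P is finite), with m = (y ⋖ w) ∷ m′,
-- a = γ(y,w), and I the increasing chain from w, with first label b.
-- If a < b, then (y ⋖ w) ∷ I is the increasing chain from y and the claim for
-- m′ extends at once. Otherwise interpolation at y ⋖ w ⋖ v gives a strictly
-- increasing chain y ⋖ u ⋯ v with labels b, …, a. The claim at u, applied to
-- this chain continued by the tail of I, shows that the increasing chain I₂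
-- from u has all labels ≥ b; so (y ⋖ u) ∷ I₂ is the increasing chain from y,
-- and the two induction hypotheses bound its labels by those of m.

open import Defs
open import Data.Integer using (ℤ; _≤_)
open import Data.List using (List)
open import Data.List.Membership.Propositional using (_∈_)
open import Data.List.Relation.Unary.All using (All)
open import Data.List.Relation.Unary.AllPairs using (AllPairs)
open import Data.Product using (_×_; ∃)
open import Relation.Binary.PropositionalEquality using (_≢_)

open import Data.Empty using (⊥-elim)
open import Data.Fin.Induction using (po-noetherian)
open import Data.Fin.Properties using (_≟_)
import Data.Integer as ℤ using (_<_)
import Data.Integer.Properties as ℤₚ
open import Data.List using ([]; _∷_; _++_; last)
open import Data.List.Membership.Propositional using (find)
open import Data.List.Membership.Propositional.Properties using (∈-++⁺ˡ; ∈-++⁺ʳ)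
open import Data.List.Relation.Binary.Subset.Propositional using (_⊆_)
open import Data.List.Relation.Binary.Subset.Propositional.Properties using (∷⁺ʳ; All-resp-⊇)
open import Data.List.Relation.Unary.All using ([]; _∷_)
import Data.List.Relation.Unary.All as All
import Data.List.Relation.Unary.All.Properties as All
open import Data.List.Relation.Unary.AllPairs using ([]; _∷_)
import Data.List.Relation.Unary.AllPairs as AllPairs
open import Data.List.Relation.Unary.Any using (Any; here; there)
import Data.List.Relation.Unary.Any as Any
import Data.List.Relation.Unary.Any.Properties as Any
open import Data.List.Relation.Unary.Linked using (Linked; []; [-]; _∷_)
import Data.List.Relation.Unary.Linked as Linked
open import Data.List.Relation.Unary.Linked.Properties
  using (Linked⇒All; Linked⇒AllPairs; AllPairs⇒Linked)
open import Data.Maybe using (just)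
open import Data.Maybe.Properties using (just-injective)
open import Data.Product using (Σ; _,_; proj₁; proj₂)
import Data.Product as Product
open import Data.Sum using (_⊎_; inj₁; inj₂)
open import Function using (_∘_; flip)
open import Induction.WellFounded using (WellFounded; Acc; acc)
open import Level using (_⊔_)
open import Relation.Binary using (Rel; Reflexive; Transitive; IsPartialOrder)
open import Relation.Binary.PropositionalEquality
  using (_≡_; refl; sym; cong; subst; ≢-sym; isEquivalence; module ≡-Reasoning)
open import Relation.Nullary using (¬_; yes; no)

last-∈ : ∀ {a} {A : Set a} {x : A} {xs} → last xs ≡ just x → x ∈ xs
last-∈ {xs = _ ∷ []}    refl = here refl
last-∈ {xs = _ ∷ _ ∷ _} eq   = there (last-∈ eq)

AllPairs-++⇒ : ∀ {a r} {A : Set a} {R : Rel A r} {x y} xs {ys} →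
               AllPairs R (xs ++ ys) → x ∈ xs → y ∈ ys → R x y
AllPairs-++⇒ (_ ∷ xs) (Rx ∷ _)  (here refl) y∈ys = All.lookup Rx (∈-++⁺ʳ xs y∈ys)
AllPairs-++⇒ (_ ∷ xs) (_ ∷ Rxs) (there x∈xs) y∈ys = AllPairs-++⇒ xs Rxs x∈xs y∈ys

module Control {a ℓ} {A : Set a} {_≤_ : Rel A ℓ}
               (≤-refl : Reflexive _≤_) (≤-trans : Transitive _≤_) where

  Linked⇒All-≤-last : ∀ {x xs} → Linked _≤_ xs → last xs ≡ just x → All (_≤ x) xs
  Linked⇒All-≤-last [-]         refl = ≤-refl ∷ []
  Linked⇒All-≤-last (y≤z ∷ zs↑) eq with Linked⇒All-≤-last zs↑ eq
  ... | z≤x ∷ zs≤x = ≤-trans y≤z z≤x ∷ z≤x ∷ zs≤x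

  InRange : List A → A → Set (a ⊔ ℓ)
  InRange xs l = Any (_≤ l) xs × Any (l ≤_) xs

  record Controls (xs ys : List A) : Set (a ⊔ ℓ) where
    field
      included : xs ⊆ ys
      distinct : AllPairs _≢_ xs
      inRange  : All (InRange xs) ys

  open Controls

  controls-[] : Controls [] []
  controls-[] = record { included = λ () ; distinct = [] ; inRange = [] }

  controls-lowerBound : ∀ {b xs ys} → Controls xs ys → All (b ≤_) xs → All (b ≤_) ys
  controls-lowerBound C b≤xs =
    All.map (λ (x≤l , _) → All.lookupWith ≤-trans b≤xs x≤l) (inRange C)

  ∷-controls : ∀ {a xs ys} → All (a ≢_) ys → Controls xs ys → Controls (a ∷ xs) (a ∷ ys)
  ∷-controls {a} a∉ys C = record
    { included = ∷⁺ʳ a (included C)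
    ; distinct = All-resp-⊇ (included C) a∉ys ∷ distinct C
    ; inRange  = (here ≤-refl , here ≤-refl) ∷ All.map (Product.map there there) (inRange C)
    }

  detour-controls : ∀ {a b xs js is ys} → b ≢ a → a ∈ js → All (_≤ a) js → All (b ≤_) ys →
                    Controls xs (b ∷ is) → Controls (js ++ is) ys → Controls (a ∷ xs) (b ∷ ys)
  detour-controls {a} {b} {xs} {js} {is} b≢a a∈js js≤a b≤ys C₁ C₂ = record
    { included = λ { (here refl) → there (included C₂ (∈-++⁺ˡ a∈js))
                   ; (there x∈xs) → ∷⁺ʳ b (included C₂ ∘ ∈-++⁺ʳ js) (included C₁ x∈xs) }
    ; distinct = All.tabulate a≢xs ∷ distinct C₁
    ; inRange  = Product.map there there b-range ∷ All.zipWith tail-range (b≤ys , inRange C₂)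
    }
    where
    b-range : InRange xs b
    b-range = All.head (inRange C₁)

    a≢xs : ∀ {x} → x ∈ xs → a ≢ x
    a≢xs x∈xs with included C₁ x∈xs
    ... | here refl  = ≢-sym b≢a
    ... | there x∈is = AllPairs-++⇒ js (distinct C₂) a∈js x∈is

    upper : ∀ {l} → Any (l ≤_) js ⊎ Any (l ≤_) is → Any (l ≤_) (a ∷ xs)
    upper (inj₁ l≤js) = here (All.lookupWith (λ x≤a l≤x → ≤-trans l≤x x≤a) js≤a l≤js)
    upper (inj₂ l≤is) =
      there (All.lookupWith (λ (_ , x≤xs) l≤x → Any.map (≤-trans l≤x) x≤xs)
                            (All.tail (inRange C₁)) l≤is)

    tail-range : ∀ {l} → b ≤ l × InRange (js ++ is) l → InRange (a ∷ xs) l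
    tail-range (b≤l , _ , l≤js++is) =
      there (Any.map (λ x≤b → ≤-trans x≤b b≤l) (proj₁ b-range)) , upper (Any.++⁻ js l≤js++is)

open Control {_≤_ = _≤_} ℤₚ.≤-refl ℤₚ.≤-trans

_++ᶜ_ : ∀ {P x w z} → Chain P x w → Chain P w z → Chain P x z
[]        ++ᶜ d = d
(x⋖w ∷ c) ++ᶜ d = x⋖w ∷ (c ++ᶜ d)

module _ (P : FinBoundedPoset) where
  open FinBoundedPoset P using (Elt; _<_; _⋖_) renaming (_≤_ to _⊑_)
  open FinBoundedPoset P using (≤-refl; ≤-trans; ≤-antisym)

  ⊑-isPartialOrder : IsPartialOrder _≡_ _⊑_
  ⊑-isPartialOrder = record
    { isPreorder = record
      { isEquivalence = isEquivalence
      ; reflexive     = λ { refl → ≤-refl }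
      ; trans         = ≤-trans }
    ; antisym = ≤-antisym }

  <-noetherian : WellFounded (flip _<_)
  <-noetherian = po-noetherian ⊑-isPartialOrder

  chain⇒⊑ : ∀ {x z} → Chain P x z → x ⊑ z
  chain⇒⊑ []        = ≤-refl
  chain⇒⊑ (x⋖w ∷ c) = ≤-trans (proj₁ (proj₁ x⋖w)) (chain⇒⊑ c)

  ⋖-chain-acyclic : ∀ {x w} → x ⋖ w → ¬ Chain P w x
  ⋖-chain-acyclic ((x⊑w , x≢w) , _) c = x≢w (≤-antisym x⊑w (chain⇒⊑ c))

  loop-vertices : ∀ {x} (c : Chain P x x) → vertices P c ≡ x ∷ []
  loop-vertices []        = refl
  loop-vertices (x⋖w ∷ c) = ⊥-elim (⋖-chain-acyclic x⋖w c)

  module _ (γ : Labelling P) where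

    labels-++ : ∀ {x w z} (c : Chain P x w) (d : Chain P w z) →
                labels P γ (c ++ᶜ d) ≡ labels P γ c ++ labels P γ d
    labels-++ []        d = refl
    labels-++ (x⋖w ∷ c) d = cong (_ ∷_) (labels-++ c d)

    labelsAlong : List Elt → List ℤ
    labelsAlong []           = []
    labelsAlong (_ ∷ [])     = []
    labelsAlong (x ∷ w ∷ ws) = γ x w ∷ labelsAlong (w ∷ ws)

    labels≡labelsAlong : ∀ {x z} (c : Chain P x z) → labels P γ c ≡ labelsAlong (vertices P c)
    labels≡labelsAlong []                = refl
    labels≡labelsAlong (x⋖w ∷ [])        = refl
    labels≡labelsAlong (x⋖w ∷ c@(_ ∷ _)) = cong (_ ∷_) (labels≡labelsAlong c)

    increasingChain-unique : ∀ {x z} {inc c : Chain P x z} → IsIncreasingChain P γ inc →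
                             WeaklyIncreasing P γ c → labels P γ c ≡ labels P γ inc
    increasingChain-unique {inc = inc} {c} (_ , unique , _) c↑ = begin
      labels P γ c                 ≡⟨ labels≡labelsAlong c ⟩
      labelsAlong (vertices P c)   ≡⟨ cong labelsAlong (unique c c↑) ⟩
      labelsAlong (vertices P inc) ≡⟨ sym (labels≡labelsAlong inc) ⟩
      labels P γ inc               ∎
      where open ≡-Reasoning

    increasingChain : IsEL P γ → ∀ {x z} → Chain P x z → Σ (Chain P x z) (IsIncreasingChain P γ)
    increasingChain el {x} {z} c with x ≟ z
    ... | yes refl =
      [] , [] , (λ c′ _ → loop-vertices c′) , (λ c′ c′≢[] → ⊥-elim (c′≢[] (loop-vertices c′)))
    ... | no x≢z   = el x z (chain⇒⊑ c , x≢z)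

module _ (P : FinBoundedPoset) (γ : Labelling P) (el : IsEL P γ) (interp : IsInterpolating P γ) where
  open FinBoundedPoset P using (_<_; _⋖_)

  controls : ∀ {y z} → Acc (flip _<_) y → (m inc : Chain P y z) → IsIncreasingChain P γ inc →
             Controls (labels P γ m) (labels P γ inc)
  controls _ [] inc inc↑ =
    subst (Controls []) (increasingChain-unique P γ inc↑ []) controls-[]
  controls {y} {z} (acc further) (_∷_ {w = w} y⋖w m) inc inc↑ =
    extend (proj₁ (increasingChain P γ el m)) (proj₂ (increasingChain P γ el m))
    where
    a : ℤ
    a = γ y w

    IH : ∀ {u} → y ⋖ u → (m′ I : Chain P u z) → IsIncreasingChain P γ I →
         Controls (labels P γ m′) (labels P γ I)
    IH y⋖u = controls (further (proj₁ y⋖u))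

    via : ∀ {xs} (c : Chain P y z) → WeaklyIncreasing P γ c →
          Controls xs (labels P γ c) → Controls xs (labels P γ inc)
    via c c↑ = subst (Controls _) (increasingChain-unique P γ inc↑ c↑)

    detour : ∀ {u v} (y⋖u : y ⋖ u) (Jt : Chain P u v) (w⋖v : w ⋖ v) (It : Chain P v z) →
             IsIncreasingChain P γ (w⋖v ∷ It) → StrictlyIncreasing P γ (y⋖u ∷ Jt) →
             γ y u ≡ γ w v → last (labels P γ Jt) ≡ just a →
             Controls (a ∷ labels P γ m) (labels P γ inc)
    detour {u} y⋖u Jt w⋖v It I↑ J↑ b≡b′ J-last =
      via (y⋖u ∷ I₂) (AllPairs⇒Linked (b≤I₂ ∷ Linked⇒AllPairs ℤₚ.≤-trans (proj₁ I₂↑)))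
          (detour-controls (ℤₚ.<⇒≢ (All.lookup b<js a∈js)) a∈js js≤a b≤I₂ C₁ C₂)
      where
      b = γ y u
      js = labels P γ Jt
      is = labels P γ It

      I₂ : Chain P u z
      I₂ = proj₁ (increasingChain P γ el (Jt ++ᶜ It))
      I₂↑ : IsIncreasingChain P γ I₂
      I₂↑ = proj₂ (increasingChain P γ el (Jt ++ᶜ It))

      C₁ : Controls (labels P γ m) (b ∷ is)
      C₁ = subst (λ t → Controls (labels P γ m) (t ∷ is)) (sym b≡b′) (IH y⋖w m (w⋖v ∷ It) I↑)
      C₂ : Controls (js ++ is) (labels P γ I₂)
      C₂ = subst (λ ls → Controls ls (labels P γ I₂)) (labels-++ P γ Jt It)
                 (IH y⋖u (Jt ++ᶜ It) I₂ I₂↑)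

      b<js : All (b ℤ.<_) js
      b<js = AllPairs.head (Linked⇒AllPairs ℤₚ.<-trans J↑)
      a∈js : a ∈ js
      a∈js = last-∈ J-last
      js≤a : All (_≤ a) js
      js≤a = Linked⇒All-≤-last (Linked.map ℤₚ.<⇒≤ (Linked.tail J↑)) J-last
      b≤is : All (b ≤_) is
      b≤is = subst (λ t → All (t ≤_) is) (sym b≡b′)
                   (AllPairs.head (Linked⇒AllPairs ℤₚ.≤-trans (proj₁ I↑)))
      b≤I₂ : All (b ≤_) (labels P γ I₂)
      b≤I₂ = controls-lowerBound C₂ (All.++⁺ (All.map ℤₚ.<⇒≤ b<js) b≤is)

    extend : (I : Chain P w z) → IsIncreasingChain P γ I → Controls (a ∷ labels P γ m) (labels P γ inc)
    extend [] I↑ = via (y⋖w ∷ []) [-] (∷-controls [] (IH y⋖w m [] I↑))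
    extend (_∷_ {w = v} w⋖v It) I↑ with interp y w v y⋖w w⋖v
    ... | inj₁ a<b =
      via (y⋖w ∷ w⋖v ∷ It) (ℤₚ.<⇒≤ a<b ∷ proj₁ I↑) (∷-controls a∉I (IH y⋖w m (w⋖v ∷ It) I↑))
      where
      a∉I : All (a ≢_) (labels P γ (w⋖v ∷ It))
      a∉I = All.map (λ b≤l → ℤₚ.<⇒≢ (ℤₚ.<-≤-trans a<b b≤l))
                    (Linked⇒All ℤₚ.≤-trans ℤₚ.≤-refl (proj₁ I↑))
    ... | inj₂ ([] , _ , _ , () , _)
    ... | inj₂ (y⋖v ∷ [] , _) = ⊥-elim (proj₂ y⋖v w (proj₁ y⋖w) (proj₁ w⋖v))
    ... | inj₂ (y⋖u ∷ Jt@(_ ∷ _) , _ , J↑ , J-head , J-last) =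
      detour y⋖u Jt w⋖v It I↑ J↑ (just-injective J-head) J-last

lemma7 : (P : FinBoundedPoset) (γ : Labelling P) →
         IsEL P γ → IsInterpolating P γ →
         ∀ {y z} (m : Chain P y z) (inc : Chain P y z) → IsIncreasingChain P γ inc →
         All (λ l → l ∈ labels P γ inc) (labels P γ m)
         × AllPairs _≢_ (labels P γ m)
         × All (λ l → (∃ λ a → a ∈ labels P γ m × a ≤ l) × (∃ λ b → b ∈ labels P γ m × l ≤ b))
               (labels P γ inc)
lemma7 P γ el interp {y} m inc inc↑ =
  All.tabulate included , distinct , All.map (Product.map find find) inRange
  where open Controls (controls P γ el interp (<-noetherian P y) m inc inc↑)
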